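{- Let $\Delta_2\ge2$ be an integer. Let $\mathcal G$ be a temporal graph such that, for every set $S$ of at most three vertices of $\mathcal G$, the induced temporal subgraph $\mathcal G[S]$ is a $(1,\Delta_2)$-cluster temporal graph. Then $\mathcal G$ is a $(1,\Delta_2)$-cluster temporal graph.
   Context: A temporal graph $\mathcal G=(G,\mathcal T)$ consists of a finite static undirected graph $G=(V,E)$ and a function $\mathcal T:E\to 2^{\mathbb Z^+}\setminus\{\emptyset\}$ (finite sets); its time-edges are $\mathcal E(\mathcal G)=\{(e,t):e\in E,\ t\in\mathcal T(e)\}$ and its lifetime is $T(\mathcal G)=\max\{t:(e,t)\in\mathcal E(\mathcal G)\}$. An interval $[a,b]$ means $\{a,\dots,b\}\subseteq\mathbb Z$. An edge $e$ is $\Delta_1$-dense in $[a,b]$ if for every $\tau\in[a,\max\{a,b-\Delta_1+1\}]$ there is $t\in\mathcal T(e)$ with $\tau\le t\le\tau+\Delta_1-1$ (for $\Delta_1=1$: $e$ appears at every time in $[a,b]$). A template is a pair $(X,[a,b])$ with $X$ a vertex set. Templates $(X,[a,b])$, $(Y,[c,d])$ are $\Delta_2$-independent if $X\cap Y=\emptyset$ or $|s-t|\ge\Delta_2$ for all $s\in[a,b]$, $t\in[c,d]$. $\mathcal G$ realises a collection $\{(X_i,[a_i,b_i])\}_i$ of pairwise $\Delta_2$-independent templates with $1\le a_i\le b_i\le T(\mathcal G)$ if every time-edge $(xy,t)$ has some $i$ with $x,y\in X_i$, $t\in[a_i,b_i]$, and for every $i$ and distinct $x,y\in X_i$, $xy$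 is an edge that is $\Delta_1$-dense in $[a_i,b_i]$; $\mathcal G$ is a $(\Delta_1,\Delta_2)$-cluster temporal graph if it realises some such collection. For $S\subseteq V$, $\mathcal G[S]$ is the temporal graph on vertex set $S$ with the time-edges of $\mathcal G$ having both endpoints in $S$. -}

module Defs where

open import Data.Nat using (ℕ; zero; suc; _+_; _∸_; _≤_; _⊔_; ∣_-_∣)
open import Data.Fin using (Fin)
open import Data.List using (List; []; foldr; map; concat; allFin)
open import Data.List.Membership.Propositional using (_∈_)
open import Data.Product using (Σ; ∃; ∃-syntax; _×_; _,_)
open import Data.Sum using (_⊎_)
open import Data.Empty using (⊥)
open import Relation.Nullary using (¬_)
open import Relation.Binary.PropositionalEquality using (_≡_; _≢_)
open import Function.Definitions using (Injective)

-- A temporal graph on vertex set Fin n.  times x y is the (finite) set of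
-- times at which the edge xy is active; xy is an edge of the underlying
-- static graph iff times x y is non-empty (T maps edges to non-empty sets).
record TemporalGraph (n : ℕ) : Set where
  field
    times  : Fin n → Fin n → List ℕ
    sym    : ∀ x y → times x y ≡ times y x
    loopless : ∀ x → times x x ≡ []
    pos    : ∀ x y t → t ∈ times x y → 1 ≤ t
open TemporalGraph public

lifetime : ∀ {n} → TemporalGraph n → ℕ
lifetime {n} G =
  foldr _⊔_ 0 (concat (map (λ x → concat (map (λ y → times G x y) (allFin n))) (allFin n)))

TimeEdge : ∀ {n} → TemporalGraph n → Fin n → Fin n → ℕ → Set
TimeEdge G x y t = t ∈ times G x y

Dense : ∀ {n} → TemporalGraph n → ℕ → Fin n → Fin n → ℕ → ℕ → Set
Dense G Δ₁ x y a b =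
  ∀ τ → a ≤ τ → τ ≤ a ⊔ ((b + 1) ∸ Δ₁) →
    ∃[ t ] (t ∈ times G x y × τ ≤ t × t ≤ (τ + Δ₁) ∸ 1)

record Template (n : ℕ) : Set where
  constructor template
  field
    X : List (Fin n)
    a : ℕ
    b : ℕ
open Template public

Disjoint : ∀ {n} → List (Fin n) → List (Fin n) → Set
Disjoint X Y = ∀ v → v ∈ X → v ∈ Y → ⊥

Independent : ∀ {n} → ℕ → Template n → Template n → Set
Independent Δ₂ P Q =
  Disjoint (X P) (X Q) ⊎
  (∀ s t → a P ≤ s → s ≤ b P → a Q ≤ t → t ≤ b Q → Δ₂ ≤ ∣ s - t ∣)

Realises : ∀ {n} → ℕ → ℕ → TemporalGraph n → (m : ℕ) → (Fin m → Template n) → Set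
Realises Δ₁ Δ₂ G m C =
  (∀ i j → i ≢ j → Independent Δ₂ (C i) (C j)) ×
  (∀ i → 1 ≤ a (C i) × a (C i) ≤ b (C i) × b (C i) ≤ lifetime G) ×
  (∀ x y t → TimeEdge G x y t →
     ∃[ i ] (x ∈ X (C i) × y ∈ X (C i) × a (C i) ≤ t × t ≤ b (C i))) ×
  (∀ i x y → x ∈ X (C i) → y ∈ X (C i) → x ≢ y →
     ¬ (times G x y ≡ []) × Dense G Δ₁ x y (a (C i)) (b (C i)))

IsCluster : ∀ {n} → ℕ → ℕ → TemporalGraph n → Set
IsCluster Δ₁ Δ₂ G = ∃[ m ] Σ (Fin m → Template _) (λ C → Realises Δ₁ Δ₂ G m C)

-- induced temporal subgraph G[S], where S is the image of an injection f : Fin k → Fin n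
induced : ∀ {n k} → TemporalGraph n → (f : Fin k → Fin n) → Injective _≡_ _≡_ f → TemporalGraph k
induced G f _ = record
  { times = λ x y → times G (f x) (f y)
  ; sym = λ x y → sym G (f x) (f y)
  ; loopless = λ x → loopless G (f x)
  ; pos = λ x y t p → pos G (f x) (f y) t p
  }

-- With Δ₁ = 1 a template forces its edges to be present at every time of its
-- interval, and since Δ₂ ≥ 2 no template can be continued by an adjacent time
-- step; so every template interval is a maximal run of consecutive times of
-- each of its edges.  Looking at three vertices at a time, maximal runs of xy
-- and xz at times closer than Δ₂ must coincide, and then yz has the same run.
-- Hence the partners of x whose run with x starts at a form, together with x,
-- a clique whose edges all share one maximal run, and two such clusters that
-- share a vertex and meet at close times are equal.  One template per cluster,
-- named by its least vertex and that vertex's least partner, realises G.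
module Submission where

open import Defs
open import Data.Nat using (ℕ; zero; suc; _+_; _*_; _∸_; _≤_; _<_; _⊔_; ∣_-_∣; z≤n; s≤s; _≤?_)
import Data.Nat as ℕ
open import Data.Nat.Properties
open import Data.Fin as Fin using (Fin; toℕ; combine; remQuot; fromℕ<)
open import Data.Fin.Patterns using (0F; 1F; 2F)
import Data.Fin.Properties as Finₚ
open import Data.List using (List; []; _∷_; foldr; filter; allFin)
open import Data.List.Properties using (foldr-preservesᵒ)
open import Data.List.Membership.Propositional using (_∈_; _∉_)
open import Data.List.Membership.Propositional.Properties
  using (∈-filter⁺; ∈-filter⁻; ∈-allFin; ∈-concat⁺′; ∈-map⁺)
open import Data.List.Membership.DecPropositional ℕ._≟_ using (_∈?_)
import Data.List.Relation.Unary.Any as Any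
open import Data.Product using (∃; ∃₂; ∃-syntax; _×_; _,_; proj₁; proj₂; map₂)
open import Data.Sum using (_⊎_; inj₁; inj₂; [_,_]′)
open import Data.Empty using (⊥-elim)
open import Function using (_∘_)
open import Function.Definitions using (Injective)
open import Relation.Nullary using (¬_; Dec; yes; no; ¬?)
open import Relation.Nullary.Decidable using (_×-dec_; _⊎-dec_; _→-dec_; decidable-stable)
open import Relation.Unary using (Decidable; _⊆_)
open import Relation.Binary.PropositionalEquality as ≡ using (_≡_; _≢_; refl; cong; subst)
open ≡.≡-Reasoning

-- Maximal runs of consecutive times

_∈[_,_] : ℕ → ℕ → ℕ → Set
t ∈[ lo , hi ] = lo ≤ t × t ≤ hi

[_,_]⊆_ : ℕ → ℕ → List ℕ → Set
[ lo , hi ]⊆ xs = ∀ t → t ∈[ lo , hi ] → t ∈ xs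

module _ {xs : List ℕ} where

  ⊆-point : ∀ {t} → t ∈ xs → [ t , t ]⊆ xs
  ⊆-point t∈ τ (t≤τ , τ≤t) = subst (_∈ xs) (≤-antisym t≤τ τ≤t) t∈

  ⊆-join : ∀ {lo t hi} → [ lo , t ]⊆ xs → [ suc t , hi ]⊆ xs → [ lo , hi ]⊆ xs
  ⊆-join {t = t} left right τ (lo≤τ , τ≤hi) with τ ≤? t
  ... | yes τ≤t = left τ (lo≤τ , τ≤t)
  ... | no τ≰t = right τ (≰⇒> τ≰t , τ≤hi)

record MaximalRun (xs : List ℕ) (lo hi : ℕ) : Set where
  field
    start≤end   : lo ≤ hi
    inside      : [ lo , hi ]⊆ xs
    pred-start∉ : lo ∸ 1 ∉ xs
    suc-end∉    : suc hi ∉ xs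

  start∈ : lo ∈ xs
  start∈ = inside lo (≤-refl , start≤end)

open MaximalRun

m<n⇒m≤n∸1 : ∀ {m n} → m < n → m ≤ n ∸ 1
m<n⇒m≤n∸1 (s≤s m≤n) = m≤n

n∸1<n : ∀ {n} → 1 ≤ n → n ∸ 1 < n
n∸1<n (s≤s z≤n) = ≤-refl

module _ {xs : List ℕ} where

  -- Truncated subtraction: a run starting at 0 would have 0 ∸ 1 = 0 ∈ xs.
  maximalRun-start-positive : ∀ {lo hi} → MaximalRun xs lo hi → 1 ≤ lo
  maximalRun-start-positive {zero} r = ⊥-elim (pred-start∉ r (start∈ r))
  maximalRun-start-positive {suc _} r = s≤s z≤n

  maximalRun-start-≤ : ∀ {lo₁ hi₁ lo₂ hi₂ t} → MaximalRun xs lo₁ hi₁ → MaximalRun xs lo₂ hi₂ →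
                       lo₂ ≤ t → t ≤ hi₁ → lo₂ ≤ lo₁
  maximalRun-start-≤ {lo₁} {lo₂ = lo₂} r₁ r₂ lo₂≤t t≤hi₁ with lo₂ ≤? lo₁
  ... | yes lo₂≤lo₁ = lo₂≤lo₁
  ... | no lo₂≰lo₁ = ⊥-elim (pred-start∉ r₂ (inside r₁ (lo₂ ∸ 1)
          (m<n⇒m≤n∸1 (≰⇒> lo₂≰lo₁) , ≤-trans (m∸n≤m lo₂ 1) (≤-trans lo₂≤t t≤hi₁))))

  maximalRun-end-≤ : ∀ {lo₁ hi₁ lo₂ hi₂ t} → MaximalRun xs lo₁ hi₁ → MaximalRun xs lo₂ hi₂ →
                     lo₁ ≤ t → t ≤ hi₂ → hi₁ ≤ hi₂
  maximalRun-end-≤ {hi₁ = hi₁} {hi₂ = hi₂} r₁ r₂ lo₁≤t t≤hi₂ with hi₁ ≤? hi₂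
  ... | yes hi₁≤hi₂ = hi₁≤hi₂
  ... | no hi₁≰hi₂ = ⊥-elim (suc-end∉ r₂ (inside r₁ (suc hi₂)
          (≤-trans lo₁≤t (m≤n⇒m≤1+n t≤hi₂) , ≰⇒> hi₁≰hi₂)))

  maximalRun-unique : ∀ {lo₁ hi₁ lo₂ hi₂ t} → MaximalRun xs lo₁ hi₁ → MaximalRun xs lo₂ hi₂ →
                      t ∈[ lo₁ , hi₁ ] → t ∈[ lo₂ , hi₂ ] → lo₁ ≡ lo₂ × hi₁ ≡ hi₂
  maximalRun-unique r₁ r₂ (lo₁≤t , t≤hi₁) (lo₂≤t , t≤hi₂) =
    ≤-antisym (maximalRun-start-≤ r₂ r₁ lo₁≤t t≤hi₂) (maximalRun-start-≤ r₁ r₂ lo₂≤t t≤hi₁) ,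
    ≤-antisym (maximalRun-end-≤ r₁ r₂ lo₁≤t t≤hi₂) (maximalRun-end-≤ r₂ r₁ lo₂≤t t≤hi₁)

  extend-left : (∀ u → u ∈ xs → 1 ≤ u) → ∀ {t} → t ∈ xs →
                ∃[ lo ] (lo ≤ t × [ lo , t ]⊆ xs × lo ∸ 1 ∉ xs)
  extend-left positive {zero} 0∈ = ⊥-elim (1+n≰n (positive 0 0∈))
  extend-left positive {suc t} st∈ with t ∈? xs
  ... | no t∉ = suc t , ≤-refl , ⊆-point st∈ , t∉
  ... | yes t∈ with extend-left positive t∈
  ...   | lo , lo≤t , ⊆t , plo∉ = lo , m≤n⇒m≤1+n lo≤t , ⊆-join ⊆t (⊆-point st∈) , plo∉

  -- k is fuel: the run found cannot end beyond t + k.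
  extend-right : ∀ k {t} → t ∈ xs → (∀ u → u ∈ xs → u ≤ t + k) →
                 ∃[ hi ] (t ≤ hi × [ t , hi ]⊆ xs × suc hi ∉ xs)
  extend-right zero {t} t∈ bounded =
    t , ≤-refl , ⊆-point t∈ , λ st∈ → 1+n≰n (subst (suc t ≤_) (+-identityʳ t) (bounded _ st∈))
  extend-right (suc k) {t} t∈ bounded with suc t ∈? xs
  ... | no st∉ = t , ≤-refl , ⊆-point t∈ , st∉
  ... | yes st∈ with extend-right k st∈ (λ u u∈ → subst (u ≤_) (+-suc t k) (bounded u u∈))
  ...   | hi , t<hi , ⊆hi , shi∉ = hi , <⇒≤ t<hi , ⊆-join (⊆-point t∈) ⊆hi , shi∉

  module _ {B : ℕ} (bounded : ∀ u → u ∈ xs → u ≤ B) where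

    private
      extend-right-bounded : ∀ {t} → t ∈ xs → ∃[ hi ] (t ≤ hi × [ t , hi ]⊆ xs × suc hi ∉ xs)
      extend-right-bounded {t} t∈ = extend-right B t∈ (λ u u∈ → ≤-trans (bounded u u∈) (m≤n+m B t))

    maximalRun-from : ∀ {lo} → lo ∈ xs → lo ∸ 1 ∉ xs → ∃[ hi ] MaximalRun xs lo hi
    maximalRun-from lo∈ plo∉ with extend-right-bounded lo∈
    ... | hi , lo≤hi , ⊆hi , shi∉ = hi , record
      { start≤end = lo≤hi ; inside = ⊆hi ; pred-start∉ = plo∉ ; suc-end∉ = shi∉ }

    maximalRun-around : (∀ u → u ∈ xs → 1 ≤ u) → ∀ {t} → t ∈ xs →
                        ∃₂ λ lo hi → MaximalRun xs lo hi × t ∈[ lo , hi ]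
    maximalRun-around positive t∈ with extend-left positive t∈ | extend-right-bounded t∈
    ... | lo , lo≤t , ⊆t , plo∉ | hi , t≤hi , t⊆ , shi∉ = lo , hi , run , lo≤t , t≤hi
      where
      run : MaximalRun xs lo hi
      run = record
        { start≤end = ≤-trans lo≤t t≤hi
        ; inside = ⊆-join ⊆t (λ τ (t<τ , τ≤hi) → t⊆ τ (<⇒≤ t<τ , τ≤hi))
        ; pred-start∉ = plo∉
        ; suc-end∉ = shi∉
        }

∈⇒≤foldr-⊔ : ∀ {t xs} → t ∈ xs → t ≤ foldr _⊔_ 0 xs
∈⇒≤foldr-⊔ {t} t∈ = foldr-preservesᵒ {P = t ≤_}
  (λ u v → [ m≤n⇒m≤n⊔o v , m≤n⇒m≤o⊔n u ]′) 0 _ (inj₂ (Any.map ≤-reflexive t∈))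

∣n-1+n∣≡1 : ∀ n → ∣ n - suc n ∣ ≡ 1
∣n-1+n∣≡1 zero = refl
∣n-1+n∣≡1 (suc n) = ∣n-1+n∣≡1 n

module _ {Δ₂ : ℕ} (1<Δ₂ : 1 < Δ₂) where

  close-refl : ∀ t → ∣ t - t ∣ < Δ₂
  close-refl t = subst (_< Δ₂) (≡.sym (∣n-n∣≡0 t)) (<-trans (s≤s z≤n) 1<Δ₂)

  close-suc : ∀ t → ∣ t - suc t ∣ < Δ₂
  close-suc t = subst (_< Δ₂) (≡.sym (∣n-1+n∣≡1 t)) 1<Δ₂

  close-pred : ∀ {t} → 1 ≤ t → ∣ t - t ∸ 1 ∣ < Δ₂
  close-pred {suc t} _ = subst (_< Δ₂) (∣-∣-comm t (suc t)) (close-suc t)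

module _ {n} (G : TemporalGraph n) where

  time-edge⇒≢ : ∀ {x y t} → TimeEdge G x y t → x ≢ y
  time-edge⇒≢ {x} {t = t} t∈ refl with subst (t ∈_) (loopless G x) t∈
  ... | ()

  maximalRun⇒≢ : ∀ {x y lo hi} → MaximalRun (times G x y) lo hi → x ≢ y
  maximalRun⇒≢ r = time-edge⇒≢ (start∈ r)

  maximalRun-sym : ∀ {x y lo hi} → MaximalRun (times G x y) lo hi → MaximalRun (times G y x) lo hi
  maximalRun-sym {x} {y} {lo} {hi} = subst (λ xs → MaximalRun xs lo hi) (sym G x y)

  time≤lifetime : ∀ {x y t} → TimeEdge G x y t → t ≤ lifetime G
  time≤lifetime {x} {y} t∈ =
    ∈⇒≤foldr-⊔ (∈-concat⁺′ (∈-concat⁺′ t∈ (∈-map⁺ _ (∈-allFin y))) (∈-map⁺ _ (∈-allFin x)))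

  dense₁⇒⊆ : ∀ {x y lo hi} → Dense G 1 x y lo hi → [ lo , hi ]⊆ times G x y
  dense₁⇒⊆ {lo = lo} {hi} dense τ (lo≤τ , τ≤hi)
    with dense τ lo≤τ (m≤n⇒m≤o⊔n lo (subst (τ ≤_) (≡.sym (m+n∸n≡m hi 1)) τ≤hi))
  ... | t , t∈ , τ≤t , t≤τ+1∸1 =
    subst (_∈ _) (≤-antisym (subst (t ≤_) (m+n∸n≡m τ 1) t≤τ+1∸1) τ≤t) t∈

  maximalRun⇒dense₁ : ∀ {x y lo hi} → MaximalRun (times G x y) lo hi →
                      ¬ (times G x y ≡ []) × Dense G 1 x y lo hi
  maximalRun⇒dense₁ {x} {y} {lo} {hi} r = nonempty , dense
    where
    nonempty : ¬ (times G x y ≡ [])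
    nonempty none with subst (lo ∈_) none (start∈ r)
    ... | ()
    dense : Dense G 1 x y lo hi
    dense τ lo≤τ τ≤ = τ , inside r τ (lo≤τ , τ≤hi) , ≤-refl , ≤-reflexive (≡.sym (m+n∸n≡m τ 1))
      where
      τ≤hi : τ ≤ hi
      τ≤hi = subst (τ ≤_) (≡.trans (cong (lo ⊔_) (m+n∸n≡m hi 1)) (m≤n⇒m⊔n≡n (start≤end r))) τ≤

-- Runs in a (1, Δ₂)-cluster temporal graph

module ClusterRealisation {Δ₂ k m} {H : TemporalGraph k} {C : Fin m → Template k}
                          (1<Δ₂ : 1 < Δ₂) (R : Realises 1 Δ₂ H m C) where

  _during_ : ℕ → Fin m → Set
  t during i = t ∈[ a (C i) , b (C i) ]

  private
    independent : ∀ i j → i ≢ j → Independent Δ₂ (C i) (C j)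
    independent = proj₁ R

    bounded : ∀ i → 1 ≤ a (C i) × a (C i) ≤ b (C i) × b (C i) ≤ lifetime H
    bounded = proj₁ (proj₂ R)

    covered : ∀ x y t → TimeEdge H x y t → ∃[ i ] (x ∈ X (C i) × y ∈ X (C i) × t during i)
    covered = proj₁ (proj₂ (proj₂ R))

    dense : ∀ i x y → x ∈ X (C i) → y ∈ X (C i) → x ≢ y → Dense H 1 x y (a (C i)) (b (C i))
    dense i x y x∈ y∈ x≢y = proj₂ (proj₂ (proj₂ (proj₂ R)) i x y x∈ y∈ x≢y)

  same-template : ∀ {i j u s t} → u ∈ X (C i) → u ∈ X (C j) → s during i → t during j →
                  ∣ s - t ∣ < Δ₂ → i ≡ j
  same-template {i} {j} u∈i u∈j (aᵢ≤s , s≤bᵢ) (aⱼ≤t , t≤bⱼ) close with i Finₚ.≟ j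
  ... | yes i≡j = i≡j
  ... | no i≢j with independent i j i≢j
  ...   | inj₁ disjoint = ⊥-elim (disjoint _ u∈i u∈j)
  ...   | inj₂ far = ⊥-elim (<⇒≱ close (far _ _ aᵢ≤s s≤bᵢ aⱼ≤t t≤bⱼ))

  time-edge-near-template : ∀ {i u v s t} → u ∈ X (C i) → s during i → TimeEdge H u v t →
                            ∣ s - t ∣ < Δ₂ → t during i
  time-edge-near-template u∈i s∈i t∈ close with covered _ _ _ t∈
  ... | j , u∈j , _ , t∈j with same-template u∈i u∈j s∈i t∈j close
  ...   | refl = t∈j

  -- Δ₂ ≥ 2 makes the neighbouring times aᵢ ∸ 1 and suc bᵢ close to the template.
  template-maximalRun : ∀ {i u v} → u ∈ X (C i) → v ∈ X (C i) → u ≢ v →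
                        MaximalRun (times H u v) (a (C i)) (b (C i))
  template-maximalRun {i} u∈i v∈i u≢v = record
    { start≤end = aᵢ≤bᵢ
    ; inside = dense₁⇒⊆ H (dense i _ _ u∈i v∈i u≢v)
    ; pred-start∉ = λ p∈ → <⇒≱ (n∸1<n 1≤aᵢ)
        (proj₁ (time-edge-near-template u∈i (≤-refl , aᵢ≤bᵢ) p∈ (close-pred 1<Δ₂ 1≤aᵢ)))
    ; suc-end∉ = λ s∈ → 1+n≰n
        (proj₂ (time-edge-near-template u∈i (aᵢ≤bᵢ , ≤-refl) s∈ (close-suc 1<Δ₂ (b (C i)))))
    }
    where
    1≤aᵢ : 1 ≤ a (C i)
    1≤aᵢ = proj₁ (bounded i)
    aᵢ≤bᵢ : a (C i) ≤ b (C i)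
    aᵢ≤bᵢ = proj₁ (proj₂ (bounded i))

  maximalRuns-meet : ∀ {u v w lo₁ hi₁ lo₂ hi₂ s t} →
    MaximalRun (times H u v) lo₁ hi₁ → MaximalRun (times H u w) lo₂ hi₂ →
    s ∈[ lo₁ , hi₁ ] → t ∈[ lo₂ , hi₂ ] → ∣ s - t ∣ < Δ₂ →
    lo₁ ≡ lo₂ × hi₁ ≡ hi₂ × (v ≢ w → MaximalRun (times H v w) lo₁ hi₁)
  maximalRuns-meet r₁ r₂ s∈ t∈ close
    with covered _ _ _ (inside r₁ _ s∈) | covered _ _ _ (inside r₂ _ t∈)
  ... | i , u∈i , v∈i , s∈i | j , u∈j , w∈j , t∈j
    with maximalRun-unique r₁ (template-maximalRun u∈i v∈i (maximalRun⇒≢ H r₁)) s∈ s∈i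
       | maximalRun-unique r₂ (template-maximalRun u∈j w∈j (maximalRun⇒≢ H r₂)) t∈ t∈j
       | same-template u∈i u∈j s∈i t∈j close
  ... | refl , refl | refl , refl | refl = refl , refl , template-maximalRun v∈i w∈j

pair : ∀ {n} → Fin n → Fin n → Fin 2 → Fin n
pair x y 0F = x
pair x y 1F = y

pair-injective : ∀ {n} {x y : Fin n} → x ≢ y → Injective _≡_ _≡_ (pair x y)
pair-injective x≢y {0F} {0F} _ = refl
pair-injective x≢y {0F} {1F} x≡y = ⊥-elim (x≢y x≡y)
pair-injective x≢y {1F} {0F} y≡x = ⊥-elim (x≢y (≡.sym y≡x))
pair-injective x≢y {1F} {1F} _ = refl

triple : ∀ {n} → Fin n → Fin n → Fin n → Fin 3 → Fin n
triple x y z 0F = x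
triple x y z 1F = y
triple x y z 2F = z

triple-injective : ∀ {n} {x y z : Fin n} → x ≢ y → x ≢ z → y ≢ z → Injective _≡_ _≡_ (triple x y z)
triple-injective x≢y x≢z y≢z {0F} {0F} _ = refl
triple-injective x≢y x≢z y≢z {0F} {1F} x≡y = ⊥-elim (x≢y x≡y)
triple-injective x≢y x≢z y≢z {0F} {2F} x≡z = ⊥-elim (x≢z x≡z)
triple-injective x≢y x≢z y≢z {1F} {0F} y≡x = ⊥-elim (x≢y (≡.sym y≡x))
triple-injective x≢y x≢z y≢z {1F} {1F} _ = refl
triple-injective x≢y x≢z y≢z {1F} {2F} y≡z = ⊥-elim (y≢z y≡z)
triple-injective x≢y x≢z y≢z {2F} {0F} z≡x = ⊥-elim (x≢z (≡.sym z≡x))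
triple-injective x≢y x≢z y≢z {2F} {1F} z≡y = ⊥-elim (y≢z (≡.sym z≡y))
triple-injective x≢y x≢z y≢z {2F} {2F} _ = refl

IsLeast : ∀ {k} → (Fin k → Set) → Fin k → Set
IsLeast P x = P x × (∀ z → P z → toℕ x ≤ toℕ z)

isLeast? : ∀ {k} {P : Fin k → Set} → Decidable P → Decidable (IsLeast P)
isLeast? P? x = P? x ×-dec Finₚ.all? (λ z → P? z →-dec (toℕ x ≤? toℕ z))

least-exists : ∀ {k} {P : Fin k → Set} → Decidable P → ∃ P → ∃ (IsLeast P)
least-exists P? (0F , p0) = 0F , p0 , λ _ _ → z≤n
least-exists P? (Fin.suc x , px) with P? 0F
... | yes p0 = 0F , p0 , λ _ _ → z≤n
... | no ¬p0 with least-exists (P? ∘ Fin.suc) (x , px)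
...   | i , pi , i≤ = Fin.suc i , pi , λ { 0F p0 → ⊥-elim (¬p0 p0) ; (Fin.suc z) pz → s≤s (i≤ z pz) }

least-unique : ∀ {k} {P Q : Fin k → Set} {x y} → IsLeast P x → IsLeast Q y → P ⊆ Q → Q ⊆ P → x ≡ y
least-unique (px , x≤) (qy , y≤) P⊆Q Q⊆P =
  Finₚ.toℕ-injective (≤-antisym (x≤ _ (Q⊆P qy)) (y≤ _ (P⊆Q px)))

time-index : ∀ {lo L} → 1 ≤ lo → lo ≤ L → ∃[ τ ] suc (toℕ {L} τ) ≡ lo
time-index {suc lo} _ lo<L = fromℕ< lo<L , cong suc (Finₚ.toℕ-fromℕ< lo<L)

-- Clusters of a temporal graph whose small induced subgraphs are cluster graphs

module LocallyCluster {Δ₂ n} (1<Δ₂ : 1 < Δ₂) (G : TemporalGraph n)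
  (locally : (k : ℕ) → k ≤ 3 → (f : Fin k → Fin n) → (inj : Injective _≡_ _≡_ f) →
             IsCluster 1 Δ₂ (induced G f inj)) where

  private
    T : Fin n → Fin n → List ℕ
    T = times G

    L : ℕ
    L = lifetime G

  maximalRuns-meet-via : ∀ {k} → k ≤ 3 → {f : Fin k → Fin n} → Injective _≡_ _≡_ f →
    ∀ {u v w lo₁ hi₁ lo₂ hi₂ s t} →
    MaximalRun (T (f u) (f v)) lo₁ hi₁ → MaximalRun (T (f u) (f w)) lo₂ hi₂ →
    s ∈[ lo₁ , hi₁ ] → t ∈[ lo₂ , hi₂ ] → ∣ s - t ∣ < Δ₂ →
    lo₁ ≡ lo₂ × hi₁ ≡ hi₂ × (v ≢ w → MaximalRun (T (f v) (f w)) lo₁ hi₁)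
  maximalRuns-meet-via {k} k≤3 {f} f-inj with locally k k≤3 f f-inj
  ... | _ , C , R = ClusterRealisation.maximalRuns-meet {H = induced G f f-inj} {C = C} 1<Δ₂ R

  maximalRuns-meet : ∀ {x y z lo₁ hi₁ lo₂ hi₂ s t} →
    MaximalRun (T x y) lo₁ hi₁ → MaximalRun (T x z) lo₂ hi₂ →
    s ∈[ lo₁ , hi₁ ] → t ∈[ lo₂ , hi₂ ] → ∣ s - t ∣ < Δ₂ →
    lo₁ ≡ lo₂ × hi₁ ≡ hi₂ × (y ≢ z → MaximalRun (T y z) lo₁ hi₁)
  maximalRuns-meet {y = y} {z} r₁ r₂ s∈ t∈ close with y Finₚ.≟ z
  ... | yes refl
    with maximalRuns-meet-via (n≤1+n 2) (pair-injective (maximalRun⇒≢ G r₁)) {0F} {1F} {1F}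
           r₁ r₂ s∈ t∈ close
  ...   | lo₁≡lo₂ , hi₁≡hi₂ , _ = lo₁≡lo₂ , hi₁≡hi₂ , λ y≢y → ⊥-elim (y≢y refl)
  maximalRuns-meet r₁ r₂ s∈ t∈ close | no y≢z
    with maximalRuns-meet-via ≤-refl (triple-injective (maximalRun⇒≢ G r₁) (maximalRun⇒≢ G r₂) y≢z)
           {0F} {1F} {2F} r₁ r₂ s∈ t∈ close
  ...   | lo₁≡lo₂ , hi₁≡hi₂ , r₃ = lo₁≡lo₂ , hi₁≡hi₂ , λ _ → r₃ (λ ())

  maximalRuns-from-same-start : ∀ {x y z lo hi₁ hi₂} →
    MaximalRun (T x y) lo hi₁ → MaximalRun (T x z) lo hi₂ →
    hi₁ ≡ hi₂ × (y ≢ z → MaximalRun (T y z) lo hi₁)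
  maximalRuns-from-same-start {lo = lo} r₁ r₂ =
    proj₂ (maximalRuns-meet r₁ r₂ (≤-refl , start≤end r₁) (≤-refl , start≤end r₂) (close-refl 1<Δ₂ lo))

  -- u is a partner of x at lo when lo starts a maximal run of the edge xu.
  Partner : Fin n → ℕ → Fin n → Set
  Partner x lo u = lo ∈ T x u × lo ∸ 1 ∉ T x u

  partner? : ∀ x lo → Decidable (Partner x lo)
  partner? x lo u = (lo ∈? T x u) ×-dec ¬? (lo ∸ 1 ∈? T x u)

  Cluster : Fin n → ℕ → Fin n → Set
  Cluster x lo u = u ≡ x ⊎ Partner x lo u

  cluster? : ∀ x lo → Decidable (Cluster x lo)
  cluster? x lo u = (u Finₚ.≟ x) ⊎-dec partner? x lo u

  maximalRun⇒partner : ∀ {x u lo hi} → MaximalRun (T x u) lo hi → Partner x lo u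
  maximalRun⇒partner r = start∈ r , pred-start∉ r

  partner⇒maximalRun : ∀ {x u lo} → Partner x lo u → ∃[ hi ] MaximalRun (T x u) lo hi
  partner⇒maximalRun (lo∈ , plo∉) = maximalRun-from (λ _ → time≤lifetime G) lo∈ plo∉

  partner-apart : ∀ {x y lo v} → Partner x lo y → Cluster x lo v → ∃[ w ] (Cluster x lo w × v ≢ w)
  partner-apart {x} {y} {v = v} py _ with v Finₚ.≟ x
  ... | yes refl = y , inj₂ py , time-edge⇒≢ G (proj₁ py)
  ... | no v≢x = x , inj₁ refl , v≢x

  module ClusterAt {x y lo hi} (r : MaximalRun (T x y) lo hi) where

    partner-run : ∀ {u} → Partner x lo u → MaximalRun (T x u) lo hi
    partner-run p with partner⇒maximalRun p
    ... | _ , r′ with maximalRuns-from-same-start r r′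
    ...   | refl , _ = r′

    member-run : ∀ {u w} → Cluster x lo u → Cluster x lo w → u ≢ w → MaximalRun (T u w) lo hi
    member-run (inj₁ refl) (inj₁ refl) u≢w = ⊥-elim (u≢w refl)
    member-run (inj₁ refl) (inj₂ pw) _ = partner-run pw
    member-run (inj₂ pu) (inj₁ refl) _ = maximalRun-sym G (partner-run pu)
    member-run (inj₂ pu) (inj₂ pw) u≢w =
      proj₂ (maximalRuns-from-same-start (partner-run pu) (partner-run pw)) u≢w

    joins : ∀ {v u} → Cluster x lo v → MaximalRun (T v u) lo hi → Cluster x lo u
    joins {u = u} _ _ with u Finₚ.≟ x
    ... | yes u≡x = inj₁ u≡x
    joins (inj₁ refl) rvu | no _ = inj₂ (maximalRun⇒partner rvu)
    joins (inj₂ pv) rvu | no u≢x = inj₂ (maximalRun⇒partner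
      (proj₂ (maximalRuns-from-same-start (maximalRun-sym G (partner-run pv)) rvu) (u≢x ∘ ≡.sym)))

  cluster-⊆ : ∀ {x y x′ y′ lo hi v} → MaximalRun (T x y) lo hi → MaximalRun (T x′ y′) lo hi →
              Cluster x lo v → Cluster x′ lo v → Cluster x lo ⊆ Cluster x′ lo
  cluster-⊆ {v = v} r r′ cv cv′ {u} cu with u Finₚ.≟ v
  ... | yes refl = cv′
  ... | no u≢v = ClusterAt.joins r′ cv′ (ClusterAt.member-run r cv cu (u≢v ∘ ≡.sym))

  Canonical : Fin n → Fin n → ℕ → Set
  Canonical x y lo = IsLeast (Cluster x lo) x × IsLeast (Partner x lo) y

  canonical? : ∀ x y lo → Dec (Canonical x y lo)
  canonical? x y lo = isLeast? (cluster? x lo) x ×-dec isLeast? (partner? x lo) y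

  canonical-unique : ∀ {x y x′ y′ lo₁ hi₁ lo₂ hi₂ v s t} →
    Canonical x y lo₁ → Canonical x′ y′ lo₂ →
    MaximalRun (T x y) lo₁ hi₁ → MaximalRun (T x′ y′) lo₂ hi₂ →
    Cluster x lo₁ v → Cluster x′ lo₂ v → s ∈[ lo₁ , hi₁ ] → t ∈[ lo₂ , hi₂ ] → ∣ s - t ∣ < Δ₂ →
    x ≡ x′ × y ≡ y′ × lo₁ ≡ lo₂
  canonical-unique (x-least , y-least) (x′-least , y′-least) r₁ r₂ cv cv′ s∈ t∈ close
    with partner-apart (proj₁ y-least) cv | partner-apart (proj₁ y′-least) cv′
  ... | w₁ , cw₁ , v≢w₁ | w₂ , cw₂ , v≢w₂
    with maximalRuns-meet (ClusterAt.member-run r₁ cv cw₁ v≢w₁)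
                          (ClusterAt.member-run r₂ cv′ cw₂ v≢w₂) s∈ t∈ close
  ... | refl , refl , _
    with least-unique x-least x′-least (cluster-⊆ r₁ r₂ cv cv′) (cluster-⊆ r₂ r₁ cv′ cv)
  ... | refl = refl , least-unique y-least y′-least (λ p → p) (λ p → p) , refl

  clusterList : Fin n → ℕ → List (Fin n)
  clusterList x lo = x ∷ filter (partner? x lo) (allFin n)

  ∈-clusterList⁻ : ∀ {x lo u} → u ∈ clusterList x lo → Cluster x lo u
  ∈-clusterList⁻ (Any.here u≡x) = inj₁ u≡x
  ∈-clusterList⁻ {x} {lo} (Any.there u∈) = inj₂ (proj₂ (∈-filter⁻ (partner? x lo) {xs = allFin n} u∈))

  ∈-clusterList⁺ : ∀ {x lo u} → Cluster x lo u → u ∈ clusterList x lo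
  ∈-clusterList⁺ (inj₁ u≡x) = Any.here u≡x
  ∈-clusterList⁺ {x} {lo} {u} (inj₂ pu) = Any.there (∈-filter⁺ (partner? x lo) (∈-allFin u) pu)

  -- Non-canonical names get an empty template, which is independent of everything.
  clusterTemplate : Fin n → Fin n → ℕ → Template n
  clusterTemplate x y lo with canonical? x y lo
  ... | yes (_ , py , _) = template (clusterList x lo) lo (proj₁ (partner⇒maximalRun py))
  ... | no _ = template [] lo lo

  clusterTemplate-bounds : ∀ x y {lo} → 1 ≤ lo → lo ≤ L →
    let P = clusterTemplate x y lo in 1 ≤ a P × a P ≤ b P × b P ≤ L
  clusterTemplate-bounds x y {lo} 1≤lo lo≤L with canonical? x y lo
  ... | no _ = 1≤lo , ≤-refl , lo≤L
  ... | yes (_ , py , _) = 1≤lo , start≤end r , time≤lifetime G (inside r _ (start≤end r , ≤-refl))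
    where r = proj₂ (partner⇒maximalRun py)

  clusterTemplate-dense : ∀ x y lo {u w} →
    let P = clusterTemplate x y lo in u ∈ X P → w ∈ X P → u ≢ w →
    ¬ (T u w ≡ []) × Dense G 1 u w (a P) (b P)
  clusterTemplate-dense x y lo u∈ w∈ u≢w with canonical? x y lo
  clusterTemplate-dense x y lo () w∈ u≢w | no _
  ... | yes (_ , py , _) = maximalRun⇒dense₁ G (ClusterAt.member-run (proj₂ (partner⇒maximalRun py))
                                                   (∈-clusterList⁻ u∈) (∈-clusterList⁻ w∈) u≢w)

  clusterTemplates-independent : ∀ x y lo x′ y′ lo′ → ¬ (x ≡ x′ × y ≡ y′ × lo ≡ lo′) →
    Independent Δ₂ (clusterTemplate x y lo) (clusterTemplate x′ y′ lo′)
  clusterTemplates-independent x y lo x′ y′ lo′ distinct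
    with canonical? x y lo | canonical? x′ y′ lo′
  ... | no _ | _ = inj₁ λ _ ()
  ... | yes _ | no _ = inj₁ λ _ _ ()
  ... | yes c₁ | yes c₂ with Finₚ.any? (λ v → cluster? x lo v ×-dec cluster? x′ lo′ v)
  ...   | no no-common = inj₁ λ v v∈ v∈′ → no-common (v , ∈-clusterList⁻ v∈ , ∈-clusterList⁻ v∈′)
  ...   | yes (v , cv , cv′) = inj₂ λ s t lo≤s s≤hi lo′≤t t≤hi′ →
    decidable-stable (Δ₂ ≤? ∣ s - t ∣) λ not-far →
      distinct (canonical-unique c₁ c₂ (proj₂ (partner⇒maximalRun (proj₁ (proj₂ c₁))))
                                       (proj₂ (partner⇒maximalRun (proj₁ (proj₂ c₂))))
                                       cv cv′ (lo≤s , s≤hi) (lo′≤t , t≤hi′) (≰⇒> not-far))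

  canonical-template : ∀ {p q w lo hi} → Canonical p q lo → MaximalRun (T p w) lo hi →
                       clusterTemplate p q lo ≡ template (clusterList p lo) lo hi
  canonical-template {p} {q} {lo = lo} c r with canonical? p q lo
  ... | no ¬c = ⊥-elim (¬c c)
  ... | yes (_ , pq , _) =
    cong (template _ lo) (proj₁ (maximalRuns-from-same-start (proj₂ (partner⇒maximalRun pq)) r))

  canonical-representative : ∀ {x y lo hi} → MaximalRun (T x y) lo hi →
    ∃₂ λ p q → Cluster p lo x × Cluster p lo y ×
               clusterTemplate p q lo ≡ template (clusterList p lo) lo hi
  canonical-representative {x} {y} {lo} {hi} r =
    p , q , same (inj₁ refl) , same (inj₂ (maximalRun⇒partner r)) ,
    canonical-template (p-least′ , proj₂ least-partner) r-pw
    where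
    least-member : ∃ (IsLeast (Cluster x lo))
    least-member = least-exists (cluster? x lo) (x , inj₁ refl)
    p : Fin n
    p = proj₁ least-member
    p-least : IsLeast (Cluster x lo) p
    p-least = proj₂ least-member
    other : ∃[ w ] (Cluster x lo w × p ≢ w)
    other = partner-apart (maximalRun⇒partner r) (proj₁ p-least)
    r-pw : MaximalRun (T p (proj₁ other)) lo hi
    r-pw = ClusterAt.member-run r (proj₁ p-least) (proj₁ (proj₂ other)) (proj₂ (proj₂ other))
    least-partner : ∃ (IsLeast (Partner p lo))
    least-partner = least-exists (partner? p lo) (_ , maximalRun⇒partner r-pw)
    q : Fin n
    q = proj₁ least-partner
    same : Cluster x lo ⊆ Cluster p lo
    same = cluster-⊆ r r-pw (proj₁ p-least) (inj₁ refl)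
    p-least′ : IsLeast (Cluster p lo) p
    p-least′ = inj₁ refl , λ z cz → proj₂ p-least z (cluster-⊆ r-pw r (inj₁ refl) (proj₁ p-least) cz)

  -- Templates are indexed by (x , y , τ), naming the cluster of x at time suc τ.
  ClusterName : Set
  ClusterName = Fin n × Fin n × Fin L

  templateAt : ClusterName → Template n
  templateAt (x , y , τ) = clusterTemplate x y (suc (toℕ τ))

  encode : ClusterName → Fin (n * (n * L))
  encode (x , y , τ) = combine x (combine y τ)

  decode : Fin (n * (n * L)) → ClusterName
  decode i = map₂ (remQuot L) (remQuot {n} (n * L) i)

  decode-encode : ∀ k → decode (encode k) ≡ k
  decode-encode (x , y , τ) = begin
    map₂ (remQuot L) (remQuot {n} (n * L) (combine x (combine y τ)))
      ≡⟨ cong (map₂ (remQuot L)) (Finₚ.remQuot-combine x (combine y τ)) ⟩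
    x , remQuot L (combine y τ)
      ≡⟨ cong (x ,_) (Finₚ.remQuot-combine y τ) ⟩
    x , y , τ ∎

  encode-decode : ∀ i → encode (decode i) ≡ i
  encode-decode i = ≡.trans (cong (combine {n} x) (Finₚ.combine-remQuot {n} L r))
                            (Finₚ.combine-remQuot {n} (n * L) i)
    where
    x : Fin n
    x = proj₁ (remQuot {n} (n * L) i)
    r : Fin (n * L)
    r = proj₂ (remQuot {n} (n * L) i)

  decode-injective : ∀ {i j} → decode i ≡ decode j → i ≡ j
  decode-injective {i} {j} eq = begin
    i                 ≡⟨ encode-decode i ⟨
    encode (decode i) ≡⟨ cong encode eq ⟩
    encode (decode j) ≡⟨ encode-decode j ⟩
    j                 ∎

  templateAt-independent : ∀ k l → k ≢ l → Independent Δ₂ (templateAt k) (templateAt l)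
  templateAt-independent (x , y , τ) (x′ , y′ , τ′) k≢l =
    clusterTemplates-independent x y _ x′ y′ _
      λ { (refl , refl , eq) → k≢l (cong (λ σ → x , y , σ) (Finₚ.toℕ-injective (suc-injective eq))) }

  timeEdges-covered : ∀ x y t → TimeEdge G x y t → ∃[ i ]
    (x ∈ X (templateAt (decode i)) × y ∈ X (templateAt (decode i)) ×
     t ∈[ a (templateAt (decode i)) , b (templateAt (decode i)) ])
  timeEdges-covered x y t t∈ with maximalRun-around (λ _ → time≤lifetime G) (pos G x y) t∈
  ... | lo , hi , r , t∈run with canonical-representative r
  ...   | p , q , cx , cy , p-template
    with time-index (maximalRun-start-positive r) (time≤lifetime G (start∈ r))
  ...     | τ , refl = encode (p , q , τ) ,
    subst (λ P → x ∈ X P × y ∈ X P × t ∈[ a P , b P ])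
          (≡.sym (≡.trans (cong templateAt (decode-encode (p , q , τ))) p-template))
          (∈-clusterList⁺ cx , ∈-clusterList⁺ cy , t∈run)

  isCluster : IsCluster 1 Δ₂ G
  isCluster = n * (n * L) , templateAt ∘ decode ,
    (λ i j i≢j → templateAt-independent (decode i) (decode j) (i≢j ∘ decode-injective)) ,
    (λ i → let (x , y , τ) = decode i in clusterTemplate-bounds x y (s≤s z≤n) (Finₚ.toℕ<n τ)) ,
    timeEdges-covered ,
    (λ i u w → let (x , y , τ) = decode i in clusterTemplate-dense x y (suc (toℕ τ)))

lemma17 : (Δ₂ : ℕ) → 2 ≤ Δ₂ → (n : ℕ) → (G : TemporalGraph n) →
    ((k : ℕ) → k ≤ 3 → (f : Fin k → Fin n) → (inj : Injective _≡_ _≡_ f) →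
      IsCluster 1 Δ₂ (induced G f inj)) →
    IsCluster 1 Δ₂ G
lemma17 Δ₂ 2≤Δ₂ n G locally = LocallyCluster.isCluster 2≤Δ₂ G locally
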